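{- The conditional term rewriting system $R$ is confluent.
   Context: Terms are built from variables and the constants $C,T,F,K,S$ by binary application, left-associated; rules apply in any context. $\mathrm{CLC}$ is the conditional system with rules $C\,T\,x\,y\to x$; $C\,F\,x\,y\to y$; $C\,z\,x\,y\to x \Leftarrow x=y$; $K\,x\,y\to x$; $S\,x\,y\,z\to x\,z\,(y\,z)$, where $=$ is convertibility in $\mathrm{CLC}$ itself, defined by levels ($\mathrm{CLC}_{(0)}$ interprets $=$ as empty, $\mathrm{CLC}_{(n+1)}$ as convertibility of $\mathrm{CLC}_{(n)}$, $\to_{\mathrm{CLC}}=\bigcup_n\to_{\mathrm{CLC}_{(n)}}$); $=_{\mathrm{CLC}}$ denotes $\mathrm{CLC}$-convertibility. $R$ is the conditional system with rules: $C\,T\,x\,y\to x$; $C\,z\,x\,y\to y \Leftarrow z=_{\mathrm{CLC}} F$; $C\,z\,x\,y\to x\Leftarrow z\neq_{\mathrm{CLC}} F \wedge x=_{\mathrm{CLC}} y$; $K\,x\,y\to x$; $S\,x\,y\,z\to x\,z\,(y\,z)$. Confluence: if $q\to_R^* q_1$ and $q\to_R^* q_2$ then $q_1,q_2$ have a common $\to_R^*$-reduct. -}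

module Defs where

open import Data.Nat using (ℕ; zero; suc)
open import Data.Empty using (⊥)
open import Data.Product using (Σ; ∃; _×_)
open import Relation.Nullary using (¬_)
open import Relation.Binary.Construct.Closure.ReflexiveTransitive using (Star)
open import Relation.Binary.Construct.Closure.Equivalence using (EqClosure)

infixl 9 _·_

data Term : Set where
  var : ℕ → Term
  C T F K S : Term
  _·_ : Term → Term → Term

data CLCRules (Cond : Term → Term → Set) : Term → Term → Set where
  cT   : ∀ x y → CLCRules Cond (C · T · x · y) x
  cF   : ∀ x y → CLCRules Cond (C · F · x · y) y
  cEq  : ∀ z x y → Cond x y → CLCRules Cond (C · z · x · y) x
  kK   : ∀ x y → CLCRules Cond (K · x · y) x
  sS   : ∀ x y z → CLCRules Cond (S · x · y · z) (x · z · (y · z))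
  appL : ∀ {s s'} t → CLCRules Cond s s' → CLCRules Cond (s · t) (s' · t)
  appR : ∀ s {t t'} → CLCRules Cond t t' → CLCRules Cond (s · t) (s · t')

CLCStep : ℕ → Term → Term → Set
CLCStep zero      = CLCRules (λ _ _ → ⊥)
CLCStep (suc n)   = CLCRules (EqClosure (CLCStep n))

_→CLC_ : Term → Term → Set
s →CLC t = ∃ λ n → CLCStep n s t

_=CLC_ : Term → Term → Set
_=CLC_ = EqClosure _→CLC_

data _→R_ : Term → Term → Set where
  rT   : ∀ x y → (C · T · x · y) →R x
  rF   : ∀ z x y → z =CLC F → (C · z · x · y) →R y
  rEq  : ∀ z x y → ¬ (z =CLC F) → x =CLC y → (C · z · x · y) →R x
  rK   : ∀ x y → (K · x · y) →R x
  rS   : ∀ x y z → (S · x · y · z) →R (x · z · (y · z))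
  appL : ∀ {s s'} t → s →R s' → (s · t) →R (s' · t)
  appR : ∀ s {t t'} → t →R t' → (s · t) →R (s · t')

_→R*_ : Term → Term → Set
_→R*_ = Star _→R_

Confluent : (Term → Term → Set) → Set
Confluent _⇒*_ = ∀ q q₁ q₂ → q ⇒* q₁ → q ⇒* q₂ → ∃ λ q₃ → (q₁ ⇒* q₃) × (q₂ ⇒* q₃)

-- The side conditions of R mention only CLC-convertibility, so a parallel
-- reduction for R has the diamond property once two facts are known: R-steps
-- are CLC-conversions (hence reducing z, x, y preserves the conditions
-- "z =CLC F", "z ≠CLC F" and "x =CLC y"), and CLC is consistent, T ≠CLC F
-- (so the rule for T and the rule for F never overlap; R's own side condition
-- separates the rule for F from the conditional one). Consistency comes from
-- Engeler's graph model, in which C is interpreted so that all CLC rules,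
-- at every level, hold as equalities of denotations.
module Submission where

open import Data.Empty using (⊥; ⊥-elim)
open import Data.List using (List; []; _∷_; _++_; [_])
open import Data.List.Membership.Propositional using (_∈_)
open import Data.List.Relation.Binary.Subset.Propositional using (_⊆_)
open import Data.List.Relation.Binary.Subset.Propositional.Properties
  using (⊆-trans; xs⊆xs++ys; xs⊆ys++xs)
open import Data.List.Relation.Unary.All as All using (All; []; _∷_)
open import Data.List.Relation.Unary.All.Properties using (++⁺; anti-mono)
open import Data.List.Relation.Unary.Any using (here; there)
open import Data.Nat using (zero; suc; _≤′_; ≤′-refl; ≤′-step; _⊔_)
open import Data.Nat.Properties using (m≤m⊔n; m≤n⊔m; ≤⇒≤′)
open import Data.Product as Product using (∃; ∃₂; _×_; _,_; proj₁)
open import Data.Sum as Sum using (_⊎_; inj₁; inj₂)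
open import Level using (0ℓ)
open import Relation.Binary.Core using (Rel; _⇒_; _=[_]⇒_)
open import Relation.Binary.Construct.Closure.Equivalence as EqClosure using (EqClosure)
open import Relation.Binary.Construct.Closure.ReflexiveTransitive as Star
  using (Star; ε; _◅_; _◅◅_)
open import Relation.Binary.Construct.Closure.Symmetric as SymClosure using (SymClosure; fwd; bwd)
open import Relation.Binary.PropositionalEquality using (refl)
import Relation.Binary.Rewriting as Rewriting
open import Relation.Nullary using (¬_)
open import Relation.Unary using (Pred; ∅; ｛_｝; _≐_)
open import Relation.Unary.Properties using (≐-refl; ≐-trans)
open import Relation.Unary.Relation.Binary.Equality using (≐-isEquivalence)

open import Defs

module _ {A : Set} where

  diamond⇒confluent : ∀ {_⟶_ : Rel A 0ℓ} →
    (∀ {t u v} → t ⟶ u → t ⟶ v → ∃ λ w → u ⟶ w × v ⟶ w) → Rewriting.Confluent _⟶_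
  diamond⇒confluent {_⟶_} ◇ = confluent
    where
    strip : ∀ {t u v} → t ⟶ u → Star _⟶_ t v → ∃ λ w → Star _⟶_ u w × v ⟶ w
    strip r ε        = _ , ε , r
    strip r (s ◅ ss) =
      let w , r′ , s′ = ◇ r s
          w′ , rs , r″ = strip s′ ss
      in w′ , r′ ◅ rs , r″

    confluent : Rewriting.Confluent _⟶_
    confluent ε        ss = _ , ss , ε
    confluent (r ◅ rs) ss =
      let w , ss′ , r′ = strip r ss
          w′ , a , b = confluent rs ss′
      in w′ , a , r′ ◅ b

  confluent-between : ∀ {_⟶_ _⇉_ : Rel A 0ℓ} → _⟶_ ⇒ _⇉_ → _⇉_ ⇒ Star _⟶_ →
                      Rewriting.Confluent _⇉_ → Rewriting.Confluent _⟶_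
  confluent-between ⟶⇒⇉ ⇉⇒⟶* confluent rs ss =
    let w , a , b = confluent (Star.map ⟶⇒⇉ rs) (Star.map ⟶⇒⇉ ss)
    in w , Star.concat (Star.map ⇉⇒⟶* a) , Star.concat (Star.map ⇉⇒⟶* b)

-- Engeler's graph model

-- A token e ↦ m is a finite piece of the graph of a function: on any
-- argument containing the finite set e it may output m.
infixr 5 _↦_
data Token : Set where
  true false : Token
  _↦_ : List Token → Token → Token

Den : Set₁
Den = Pred Token 0ℓ

infixl 9 _∙_
_∙_ : Den → Den → Den
(f ∙ a) m = ∃ λ e → All a e × f (e ↦ m)

variable
  f f′ a a′ x y z : Den

∙-cong : f ≐ f′ → a ≐ a′ → f ∙ a ≐ f′ ∙ a′
∙-cong (f⊆f′ , f′⊆f) (a⊆a′ , a′⊆a) =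
  (λ (e , ae , fe) → e , All.map a⊆a′ ae , f⊆f′ fe) ,
  (λ (e , ae , fe) → e , All.map a′⊆a ae , f′⊆f fe)

graph₂ : (List Token → List Token → Token → Set) → Den
graph₂ P (e₁ ↦ e₂ ↦ m) = P e₁ e₂ m
graph₂ P _             = ⊥

graph₃ : (List Token → List Token → List Token → Token → Set) → Den
graph₃ P (e₁ ↦ e₂ ↦ e₃ ↦ m) = P e₁ e₂ e₃ m
graph₃ P _                  = ⊥

Kᴰ : Den
Kᴰ = graph₂ λ e₁ _ m → m ∈ e₁

Sᴰ : Den
Sᴰ = graph₃ λ e₁ e₂ e₃ m → ∃₂ λ d e →
  (d ↦ e ↦ m) ∈ e₁ × d ⊆ e₃ × All (λ b → ∃ λ d′ → (d′ ↦ b) ∈ e₂ × d′ ⊆ e₃) e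

Cᴰ : Den
Cᴰ = graph₃ λ e₁ e₂ e₃ m →
  (true ∈ e₁ × m ∈ e₂) ⊎ (false ∈ e₁ × m ∈ e₃) ⊎ (m ∈ e₂ × m ∈ e₃)

-- The third disjunct makes C z x y → x sound when x = y, whatever z is.
cond : Den → Den → Den → Den
cond z x y m = (z true × x m) ⊎ (z false × y m) ⊎ (x m × y m)

K-∙ : Kᴰ ∙ x ∙ y ≐ x
K-∙ = (λ (_ , _ , _ , xe , i) → All.lookup xe i)
    , (λ {m} xm → [] , [] , [ m ] , xm ∷ [] , here refl)

-- The finitely many witnesses d′ for the tokens b ∈ e are pooled into a
-- single finite argument e₃ for S.
pool : ∀ {e} → All (λ b → ∃ λ d → All z d × y (d ↦ b)) e →
       ∃₂ λ e₂ e₃ → All y e₂ × All z e₃ ×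
         All (λ b → ∃ λ d → (d ↦ b) ∈ e₂ × d ⊆ e₃) e
pool [] = [] , [] , [] , [] , []
pool {e = b ∷ _} ((d , zd , yd) ∷ rest) =
  let e₂ , e₃ , ye₂ , ze₃ , cover = pool rest in
  (d ↦ b) ∷ e₂ , d ++ e₃ , yd ∷ ye₂ , ++⁺ zd ze₃ ,
  (d , here refl , xs⊆xs++ys d e₃) ∷
  All.map (λ (d′ , i , d′⊆e₃) →
             d′ , there i , (λ {_} → ⊆-trans d′⊆e₃ (xs⊆ys++xs e₃ d)))
          cover

S-∙ : Sᴰ ∙ x ∙ y ∙ z ≐ x ∙ z ∙ (y ∙ z)
S-∙ {x} {y} {z} = to , from
  where
  to : ∀ {m} → (Sᴰ ∙ x ∙ y ∙ z) m → (x ∙ z ∙ (y ∙ z)) m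
  to (_ , ze₃ , _ , ye₂ , _ , xe₁ , d , e , i , d⊆e₃ , cover) =
    e , All.map (λ (d′ , j , d′⊆e₃) → d′ , anti-mono d′⊆e₃ ze₃ , All.lookup ye₂ j) cover ,
    d , anti-mono d⊆e₃ ze₃ , All.lookup xe₁ i

  from : ∀ {m} → (x ∙ z ∙ (y ∙ z)) m → (Sᴰ ∙ x ∙ y ∙ z) m
  from {m} (e , yze , d , zd , xd) =
    let e₂ , e₃ , ye₂ , ze₃ , cover = pool yze in
    d ++ e₃ , ++⁺ zd ze₃ , e₂ , ye₂ , [ d ↦ e ↦ m ] , xd ∷ [] ,
    d , e , here refl , xs⊆xs++ys d e₃ ,
    All.map (λ (d′ , j , d′⊆e₃) → d′ , j , (λ {_} → ⊆-trans d′⊆e₃ (xs⊆ys++xs e₃ d))) cover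

C-∙ : Cᴰ ∙ z ∙ x ∙ y ≐ cond z x y
C-∙ {z} {x} {y} = to , from
  where
  to : ∀ {m} → (Cᴰ ∙ z ∙ x ∙ y) m → cond z x y m
  to (_ , ye₃ , _ , xe₂ , _ , ze₁ , c) =
    Sum.map (Product.map (All.lookup ze₁) (All.lookup xe₂))
      (Sum.map (Product.map (All.lookup ze₁) (All.lookup ye₃))
               (Product.map (All.lookup xe₂) (All.lookup ye₃))) c

  from : ∀ {m} → cond z x y m → (Cᴰ ∙ z ∙ x ∙ y) m
  from {m} (inj₁ (zt , xm)) =
    [] , [] , [ m ] , xm ∷ [] , [ true ] , zt ∷ [] , inj₁ (here refl , here refl)
  from {m} (inj₂ (inj₁ (zf , ym))) =
    [ m ] , ym ∷ [] , [] , [] , [ false ] , zf ∷ [] , inj₂ (inj₁ (here refl , here refl))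
  from {m} (inj₂ (inj₂ (xm , ym))) =
    [ m ] , ym ∷ [] , [ m ] , xm ∷ [] , [] , [] , inj₂ (inj₂ (here refl , here refl))

cond-true : cond ｛ true ｝ x y ≐ x
cond-true = (λ { (inj₁ (_ , xm)) → xm ; (inj₂ (inj₁ (() , _))) ; (inj₂ (inj₂ (xm , _))) → xm })
          , (λ xm → inj₁ (refl , xm))

cond-false : cond ｛ false ｝ x y ≐ y
cond-false = (λ { (inj₁ (() , _)) ; (inj₂ (inj₁ (_ , ym))) → ym ; (inj₂ (inj₂ (_ , ym))) → ym })
           , (λ ym → inj₂ (inj₁ (refl , ym)))

cond-≐ : x ≐ y → cond z x y ≐ x
cond-≐ (x⊆y , y⊆x) =
  (λ { (inj₁ (_ , xm)) → xm ; (inj₂ (inj₁ (_ , ym))) → y⊆x ym ; (inj₂ (inj₂ (xm , _))) → xm })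
  , (λ xm → inj₂ (inj₂ (xm , x⊆y xm)))

⟦_⟧ : Term → Den
⟦ var _ ⟧ = ∅
⟦ C ⟧     = Cᴰ
⟦ T ⟧     = ｛ true ｝
⟦ F ⟧     = ｛ false ｝
⟦ K ⟧     = Kᴰ
⟦ S ⟧     = Sᴰ
⟦ s · t ⟧ = ⟦ s ⟧ ∙ ⟦ t ⟧

CLCRules-sound : ∀ {Cond : Rel Term 0ℓ} → Cond =[ ⟦_⟧ ]⇒ _≐_ → CLCRules Cond =[ ⟦_⟧ ]⇒ _≐_
CLCRules-sound sound (cT _ _)        = ≐-trans C-∙ cond-true
CLCRules-sound sound (cF _ _)        = ≐-trans C-∙ cond-false
CLCRules-sound sound (cEq z _ _ x=y) = ≐-trans C-∙ (cond-≐ {z = ⟦ z ⟧} (sound x=y))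
CLCRules-sound sound (kK _ _)        = K-∙
CLCRules-sound sound (sS _ _ _)      = S-∙
CLCRules-sound sound (appL t r)      = ∙-cong {a = ⟦ t ⟧} (CLCRules-sound sound r) ≐-refl
CLCRules-sound sound (appR s r)      = ∙-cong {f = ⟦ s ⟧} ≐-refl (CLCRules-sound sound r)

CLCStep-sound : ∀ n → CLCStep n =[ ⟦_⟧ ]⇒ _≐_
CLCStep-sound zero    = CLCRules-sound λ ()
CLCStep-sound (suc n) = CLCRules-sound (EqClosure.gfold ≐-isEquivalence ⟦_⟧ (CLCStep-sound n))

=CLC-sound : _=CLC_ =[ ⟦_⟧ ]⇒ _≐_
=CLC-sound = EqClosure.gfold ≐-isEquivalence ⟦_⟧ λ (n , r) → CLCStep-sound n r

T≠CLCF : ¬ (T =CLC F)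
T≠CLCF T=F with proj₁ (=CLC-sound T=F) refl
... | ()

CLCRules-map : ∀ {P Q : Rel Term 0ℓ} → P ⇒ Q → CLCRules P ⇒ CLCRules Q
CLCRules-map P⇒Q (cT x y)       = cT x y
CLCRules-map P⇒Q (cF x y)       = cF x y
CLCRules-map P⇒Q (cEq z x y c)  = cEq z x y (P⇒Q c)
CLCRules-map P⇒Q (kK x y)       = kK x y
CLCRules-map P⇒Q (sS x y z)     = sS x y z
CLCRules-map P⇒Q (appL t r)     = appL t (CLCRules-map P⇒Q r)
CLCRules-map P⇒Q (appR s r)     = appR s (CLCRules-map P⇒Q r)

CLCStep-suc : ∀ n → CLCStep n ⇒ CLCStep (suc n)
CLCStep-suc zero    = CLCRules-map λ ()
CLCStep-suc (suc n) = CLCRules-map (EqClosure.map (CLCStep-suc n))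

CLCStep-mono : ∀ {m n} → m ≤′ n → CLCStep m ⇒ CLCStep n
CLCStep-mono ≤′-refl        r = r
CLCStep-mono (≤′-step m≤′n) r = CLCStep-suc _ (CLCStep-mono m≤′n r)

-- The conditional rule of level n + 1 needs its condition inside a single level n.
=CLC⇒CLCStep-conv : ∀ {s t} → s =CLC t → ∃ λ n → EqClosure (CLCStep n) s t
=CLC⇒CLCStep-conv ε        = zero , ε
=CLC⇒CLCStep-conv (r ◅ rs) = cons (atLevel r) (=CLC⇒CLCStep-conv rs)
  where
  atLevel : ∀ {s t} → SymClosure _→CLC_ s t → ∃ λ n → SymClosure (CLCStep n) s t
  atLevel (fwd (n , r)) = n , fwd r
  atLevel (bwd (n , r)) = n , bwd r

  cons : ∀ {s t u} → (∃ λ n → SymClosure (CLCStep n) s t) →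
         (∃ λ k → EqClosure (CLCStep k) t u) → ∃ λ n → EqClosure (CLCStep n) s u
  cons (n , r) (k , rs) =
    n ⊔ k , SymClosure.map (CLCStep-mono (≤⇒≤′ (m≤m⊔n n k))) r
          ◅ EqClosure.map (CLCStep-mono (≤⇒≤′ (m≤n⊔m n k))) rs

=CLC-sym : ∀ {s t} → s =CLC t → t =CLC s
=CLC-sym = EqClosure.symmetric _→CLC_

CLCStep-·ˡ : ∀ n {s s′} t → CLCStep n s s′ → CLCStep n (s · t) (s′ · t)
CLCStep-·ˡ zero    t = appL t
CLCStep-·ˡ (suc n) t = appL t

CLCStep-·ʳ : ∀ n s {t t′} → CLCStep n t t′ → CLCStep n (s · t) (s · t′)
CLCStep-·ʳ zero    s = appR s
CLCStep-·ʳ (suc n) s = appR s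

=CLC-· : ∀ {s s′ t t′} → s =CLC s′ → t =CLC t′ → (s · t) =CLC (s′ · t′)
=CLC-· {s′ = s′} {t} s=s′ t=t′ =
  EqClosure.gmap (_· t) (λ (n , r) → n , CLCStep-·ˡ n t r) s=s′ ◅◅
  EqClosure.gmap (s′ ·_) (λ (n , r) → n , CLCStep-·ʳ n s′ r) t=t′

-- Parallel reduction for R

infix 4 _⇛_
data _⇛_ : Term → Term → Set where
  var : ∀ n → var n ⇛ var n
  C   : C ⇛ C
  T   : T ⇛ T
  F   : F ⇛ F
  K   : K ⇛ K
  S   : S ⇛ S
  _·_ : ∀ {s s′ t t′} → s ⇛ s′ → t ⇛ t′ → s · t ⇛ s′ · t′
  rT  : ∀ {x x′} y → x ⇛ x′ → C · T · x · y ⇛ x′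
  rF  : ∀ {z} x {y y′} → z =CLC F → y ⇛ y′ → C · z · x · y ⇛ y′
  rEq : ∀ {z x x′} y → ¬ (z =CLC F) → x =CLC y → x ⇛ x′ → C · z · x · y ⇛ x′
  rK  : ∀ {x x′} y → x ⇛ x′ → K · x · y ⇛ x′
  rS  : ∀ {x x′ y y′ z z′} → x ⇛ x′ → y ⇛ y′ → z ⇛ z′ → S · x · y · z ⇛ x′ · z′ · (y′ · z′)

⇛-refl : ∀ t → t ⇛ t
⇛-refl (var n) = var n
⇛-refl C       = C
⇛-refl T       = T
⇛-refl F       = F
⇛-refl K       = K
⇛-refl S       = S
⇛-refl (s · t) = ⇛-refl s · ⇛-refl t

⇛⇒=CLC : _⇛_ ⇒ _=CLC_
⇛⇒=CLC (var n)   = ε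
⇛⇒=CLC C         = ε
⇛⇒=CLC T         = ε
⇛⇒=CLC F         = ε
⇛⇒=CLC K         = ε
⇛⇒=CLC S         = ε
⇛⇒=CLC (ds · dt) = =CLC-· (⇛⇒=CLC ds) (⇛⇒=CLC dt)
⇛⇒=CLC (rT y dx) = EqClosure.return (0 , cT _ y) ◅◅ ⇛⇒=CLC dx
⇛⇒=CLC (rF x z=F dy) =
  =CLC-· (=CLC-· (=CLC-· ε z=F) ε) ε ◅◅ EqClosure.return (0 , cF x _) ◅◅ ⇛⇒=CLC dy
⇛⇒=CLC (rEq y _ x=y dx) =
  let n , x=ₙy = =CLC⇒CLCStep-conv x=y in
  EqClosure.return (suc n , cEq _ _ y x=ₙy) ◅◅ ⇛⇒=CLC dx
⇛⇒=CLC (rK y dx) = EqClosure.return (0 , kK _ y) ◅◅ ⇛⇒=CLC dx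
⇛⇒=CLC (rS dx dy dz) =
  EqClosure.return (0 , sS _ _ _) ◅◅
  =CLC-· (=CLC-· (⇛⇒=CLC dx) (⇛⇒=CLC dz)) (=CLC-· (⇛⇒=CLC dy) (⇛⇒=CLC dz))

⇛-resp-=CLC : ∀ {x x′ y y′} → x ⇛ x′ → y ⇛ y′ → x =CLC y → x′ =CLC y′
⇛-resp-=CLC dx dy x=y = =CLC-sym (⇛⇒=CLC dx) ◅◅ x=y ◅◅ ⇛⇒=CLC dy

⇛-resp-≠CLC : ∀ {x x′ y y′} → x ⇛ x′ → y ⇛ y′ → ¬ (x =CLC y) → ¬ (x′ =CLC y′)
⇛-resp-≠CLC dx dy x≠y x′=y′ = x≠y (⇛⇒=CLC dx ◅◅ x′=y′ ◅◅ =CLC-sym (⇛⇒=CLC dy))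

Joinable : Term → Term → Set
Joinable u v = ∃ λ w → u ⇛ w × v ⇛ w

Joinable-sym : ∀ {u v} → Joinable u v → Joinable v u
Joinable-sym (w , a , b) = w , b , a

·-joinable : ∀ {s s′ t t′} → Joinable s s′ → Joinable t t′ → Joinable (s · t) (s′ · t′)
·-joinable (w , a , b) (w′ , a′ , b′) = w · w′ , a · a′ , b · b′

rT-joinable : ∀ {x x′} y → Joinable x x′ → Joinable (C · T · x · y) x′
rT-joinable y (w , a , b) = w , rT y a , b

rF-joinable : ∀ {z y y′} x → z =CLC F → Joinable y y′ → Joinable (C · z · x · y) y′
rF-joinable x z=F (w , a , b) = w , rF x z=F a , b

rEq-joinable : ∀ {z x x′} y → ¬ (z =CLC F) → x =CLC y → Joinable x x′ →
               Joinable (C · z · x · y) x′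
rEq-joinable y z≠F x=y (w , a , b) = w , rEq y z≠F x=y a , b

rK-joinable : ∀ {x x′} y → Joinable x x′ → Joinable (K · x · y) x′
rK-joinable y (w , a , b) = w , rK y a , b

rS-joinable : ∀ {x x′ y y′ z z′} → Joinable x x′ → Joinable y y′ → Joinable z z′ →
              Joinable (S · x · y · z) (x′ · z′ · (y′ · z′))
rS-joinable (wx , ax , bx) (wy , ay , by) (wz , az , bz) =
  wx · wz · (wy · wz) , rS ax ay az , bx · bz · (by · bz)

⇛-diamond : ∀ {t u v} → t ⇛ u → t ⇛ v → Joinable u v
⇛-diamond (var n) (var n) = var n , var n , var n
⇛-diamond C C             = C , C , C
⇛-diamond T T             = T , T , T
⇛-diamond F F             = F , F , F
⇛-diamond K K             = K , K , K
⇛-diamond S S             = S , S , S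
⇛-diamond (ds · dt) (ds′ · dt′) = ·-joinable (⇛-diamond ds ds′) (⇛-diamond dt dt′)
⇛-diamond (C · T · dx · _) (rT y dx′) = rT-joinable _ (⇛-diamond dx dx′)
⇛-diamond (rT y dx) (C · T · dx′ · _) = Joinable-sym (rT-joinable _ (⇛-diamond dx′ dx))
⇛-diamond (C · dz · _ · dy) (rF x z=F dy′) =
  rF-joinable _ (⇛-resp-=CLC dz F z=F) (⇛-diamond dy dy′)
⇛-diamond (rF x z=F dy) (C · dz · _ · dy′) =
  Joinable-sym (rF-joinable _ (⇛-resp-=CLC dz F z=F) (⇛-diamond dy′ dy))
⇛-diamond (C · dz · dx · dy) (rEq y z≠F x=y dx′) =
  rEq-joinable _ (⇛-resp-≠CLC dz F z≠F) (⇛-resp-=CLC dx dy x=y) (⇛-diamond dx dx′)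
⇛-diamond (rEq y z≠F x=y dx) (C · dz · dx′ · dy′) =
  Joinable-sym (rEq-joinable _ (⇛-resp-≠CLC dz F z≠F) (⇛-resp-=CLC dx′ dy′ x=y)
                               (⇛-diamond dx′ dx))
⇛-diamond (K · dx · _) (rK y dx′) = rK-joinable _ (⇛-diamond dx dx′)
⇛-diamond (rK y dx) (K · dx′ · _) = Joinable-sym (rK-joinable _ (⇛-diamond dx′ dx))
⇛-diamond (S · dx · dy · dz) (rS dx′ dy′ dz′) =
  rS-joinable (⇛-diamond dx dx′) (⇛-diamond dy dy′) (⇛-diamond dz dz′)
⇛-diamond (rS dx dy dz) (S · dx′ · dy′ · dz′) =
  Joinable-sym (rS-joinable (⇛-diamond dx′ dx) (⇛-diamond dy′ dy) (⇛-diamond dz′ dz))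
⇛-diamond (rT _ dx) (rT _ dx′)           = ⇛-diamond dx dx′
⇛-diamond (rT _ dx) (rEq _ _ _ dx′)      = ⇛-diamond dx dx′
⇛-diamond (rEq _ _ _ dx) (rT _ dx′)      = ⇛-diamond dx dx′
⇛-diamond (rEq _ _ _ dx) (rEq _ _ _ dx′) = ⇛-diamond dx dx′
⇛-diamond (rF _ _ dy) (rF _ _ dy′)       = ⇛-diamond dy dy′
⇛-diamond (rK _ dx) (rK _ dx′)           = ⇛-diamond dx dx′
⇛-diamond (rS dx dy dz) (rS dx′ dy′ dz′) =
  ·-joinable (·-joinable (⇛-diamond dx dx′) (⇛-diamond dz dz′))
             (·-joinable (⇛-diamond dy dy′) (⇛-diamond dz dz′))
⇛-diamond (rT _ _) (rF _ T=F _)          = ⊥-elim (T≠CLCF T=F)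
⇛-diamond (rF _ T=F _) (rT _ _)          = ⊥-elim (T≠CLCF T=F)
⇛-diamond (rF _ z=F _) (rEq _ z≠F _ _)   = ⊥-elim (z≠F z=F)
⇛-diamond (rEq _ z≠F _ _) (rF _ z=F _)   = ⊥-elim (z≠F z=F)

R⇒⇛ : _→R_ ⇒ _⇛_
R⇒⇛ (rT x y)            = rT y (⇛-refl x)
R⇒⇛ (rF z x y z=F)      = rF x z=F (⇛-refl y)
R⇒⇛ (rEq z x y z≠F x=y) = rEq y z≠F x=y (⇛-refl x)
R⇒⇛ (rK x y)            = rK y (⇛-refl x)
R⇒⇛ (rS x y z)          = rS (⇛-refl x) (⇛-refl y) (⇛-refl z)
R⇒⇛ (appL t r)          = R⇒⇛ r · ⇛-refl t
R⇒⇛ (appR s r)          = ⇛-refl s · R⇒⇛ r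

→R*-· : ∀ {s s′ t t′} → s →R* s′ → t →R* t′ → (s · t) →R* (s′ · t′)
→R*-· {s′ = s′} {t} s→s′ t→t′ =
  Star.gmap (_· t) (appL t) s→s′ ◅◅ Star.gmap (s′ ·_) (appR s′) t→t′

⇛⇒R* : _⇛_ ⇒ _→R*_
⇛⇒R* (var n)            = ε
⇛⇒R* C                  = ε
⇛⇒R* T                  = ε
⇛⇒R* F                  = ε
⇛⇒R* K                  = ε
⇛⇒R* S                  = ε
⇛⇒R* (ds · dt)          = →R*-· (⇛⇒R* ds) (⇛⇒R* dt)
⇛⇒R* (rT y dx)          = rT _ y ◅ ⇛⇒R* dx
⇛⇒R* (rF x z=F dy)      = rF _ x _ z=F ◅ ⇛⇒R* dy
⇛⇒R* (rEq y z≠F x=y dx) = rEq _ _ y z≠F x=y ◅ ⇛⇒R* dx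
⇛⇒R* (rK y dx)          = rK _ y ◅ ⇛⇒R* dx
⇛⇒R* (rS dx dy dz) =
  rS _ _ _ ◅ →R*-· (→R*-· (⇛⇒R* dx) (⇛⇒R* dz)) (→R*-· (⇛⇒R* dy) (⇛⇒R* dz))

mainTheorem7 : Confluent _→R*_
mainTheorem7 _ _ _ = confluent-between R⇒⇛ ⇛⇒R* (diamond⇒confluent ⇛-diamond)
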